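{- Let $G=(V,E)$ be a graph on $n$ vertices with maximum degree $\Delta$, and let $t:V\to\mathbb{N}$ be a threshold function such that every edge $(u,v)\in E$ satisfies $\frac{t(u)}{d(u)}+\frac{t(v)}{d(v)}\ge1$. Let $M(G)=\max_{v\in V}\frac{d(v)}{t(v)}$ and suppose $M(G)\ge 2$. If $(G,t)$ has a contagious set of size $r$, then $CW(G)\le (M(G)-1)\Delta r$.
   Context: For a graph $G$ with threshold function $t$, the activation process starts with an active set $S$, and in discrete time steps every inactive vertex $v$ having at least $t(v)$ neighbors that were active in the previous step becomes active; $S$ is contagious (a target set) if eventually all vertices are active. The cutwidth $CW(G)$ is the minimum, over all linear orderings $\sigma$ of $V$, of the maximum over all prefixes of $\sigma$ of the number of edges with exactly one endpoint in the prefix. $d(v)$ is the degree of $v$. -}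

module Defs where

open import Data.Nat as ℕ using (ℕ; zero; suc; _⊔_; _<ᵇ_; NonZero)
open import Data.Bool using (Bool; true; false; _∧_; _∨_; not; if_then_else_)
open import Data.Fin using (Fin; toℕ)
open import Data.List using (List; foldr; map; allFin; upTo)
open import Data.Integer using (+_)
open import Data.Rational as ℚ using (ℚ)
open import Data.Fin.Permutation using (Permutation′; _⟨$⟩ʳ_)
open import Data.Product using (∃)
open import Relation.Binary.PropositionalEquality using (_≡_)

count : {n : ℕ} → (Fin n → Bool) → ℕ
count {n} P = foldr (λ v acc → if P v then suc acc else acc) 0 (allFin n)

maxℕ : {A : Set} → List A → (A → ℕ) → ℕ
maxℕ xs f = foldr (λ x acc → f x ⊔ acc) 0 (map (λ x → x) xs)

record Graph (n : ℕ) : Set where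
  field
    adj     : Fin n → Fin n → Bool
    symm    : ∀ u v → adj u v ≡ adj v u
    irrefl  : ∀ v → adj v v ≡ false
open Graph public

deg : {n : ℕ} → Graph n → Fin n → ℕ
deg G u = count (adj G u)

maxDeg : {n : ℕ} → Graph n → ℕ
maxDeg {n} G = maxℕ (allFin n) (deg G)

VSet : ℕ → Set
VSet n = Fin n → Bool

size : {n : ℕ} → VSet n → ℕ
size = count

active : {n : ℕ} → Graph n → (Fin n → ℕ) → VSet n → ℕ → VSet n
active G t S zero    v = S v
active G t S (suc k) v =
  active G t S k v ∨ ℕ._≤ᵇ_ (t v) (count (λ u → adj G v u ∧ active G t S k u))

Contagious : {n : ℕ} → Graph n → (Fin n → ℕ) → VSet n → Set
Contagious G t S = ∃ λ k → ∀ v → active G t S k v ≡ true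

-- Linear orderings: σ maps a vertex to its position.  The prefix of length i
-- is the set of vertices at position < i.
inPrefix : {n : ℕ} → Permutation′ n → ℕ → Fin n → Bool
inPrefix σ i v = toℕ (σ ⟨$⟩ʳ v) <ᵇ i

-- Number of edges with exactly one endpoint in the prefix of length i
-- (each such edge is counted once, via its endpoint u inside the prefix).
cutSize : {n : ℕ} → Graph n → Permutation′ n → ℕ → ℕ
cutSize {n} G σ i =
  foldr ℕ._+_ 0
    (map (λ u → count (λ v → adj G u v ∧ inPrefix σ i u ∧ not (inPrefix σ i v)))
         (allFin n))

width : {n : ℕ} → Graph n → Permutation′ n → ℕ
width {n} G σ = maxℕ (upTo (suc n)) (cutSize G σ)

-- CW(G) ≤ b  (CW is the minimum width over all orderings).
CutwidthAtMost : {n : ℕ} → Graph n → ℚ → Set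
CutwidthAtMost G b = ∃ λ σ → (+ width G σ) ℚ./ 1 ℚ.≤ b

ratio : {n : ℕ} → Graph n → (t : Fin n → ℕ) → (∀ v → NonZero (t v)) → Fin n → ℚ
ratio G t tpos v = (+ deg G v) ℚ./ t v
  where instance _ = tpos v

-- M(G) = max_v d(v)/t(v)  (0 for the empty graph).
M : {n : ℕ} → Graph n → (t : Fin n → ℕ) → (∀ v → NonZero (t v)) → ℚ
M {n} G t tpos = foldr (λ v acc → ratio G t tpos v ℚ.⊔ acc) ℚ.0ℚ (allFin n)

EdgeCondition : {n : ℕ} → Graph n → (Fin n → ℕ) → Set
EdgeCondition G t = ∀ u v → adj G u v ≡ true →
  (dpu : NonZero (deg G u)) → (dpv : NonZero (deg G v)) →
  ℚ.1ℚ ℚ.≤ ((+ t u) ℚ./ deg G u) {{dpu}} ℚ.+ ((+ t v) ℚ./ deg G v) {{dpv}}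

-- Order the vertices by the step at which they become active, ties broken by index, and
-- follow the prefixes P of this order.  With w(u) = min(M t(u)/d(u), M - 1), the potential
-- Φ(P) = Σ_{u ∈ P} w(u) |N(u) ∖ P| dominates the cut of P, since d(u)/t(u) ≤ M and M ≥ 2 give
-- w(u) ≥ 1 for every non-isolated u.  While P consists of seeds, Φ(P) ≤ (M - 1) Δ r.  Every
-- later vertex v has k ≥ t(v) neighbours in the preceding prefix; appending it adds
-- w(v)(d(v) - k) ≤ a (d(v) - k) ≤ k (M - a) with a = M t(v)/d(v), and removes w(u) ≥ M - a
-- for each of those k neighbours u (this is the edge condition), so Φ never increases.

module Submission where

open import Defs
open import Level using (Level)
open import Data.Nat as ℕ using (ℕ; zero; suc; _≤_; _<_; _≤′_; ≤′-refl; ≤′-step; _<ᵇ_; z≤n; s≤s; NonZero)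
import Data.Nat.Properties as ℕ
open import Data.Bool using (Bool; true; false; T; T?; _∧_; _∨_; not; if_then_else_)
import Data.Bool.Properties as Bool
open import Data.Fin as Fin using (Fin; toℕ; fromℕ<; _≟_)
import Data.Fin.Properties as Fin
open import Data.Fin.Permutation using (Permutation′; permutation; _⟨$⟩ʳ_; _⟨$⟩ˡ_; inverseʳ)
open import Data.List using ([]; _∷_; foldr; map; tabulate; upTo)
open import Data.List.Membership.Propositional using (_∈_)
open import Data.List.Membership.Propositional.Properties using (∈-allFin)
open import Data.List.Relation.Unary.Any using (here; there)
open import Data.Integer as ℤ using (+_)
import Data.Integer.Properties as ℤ
open import Data.Integer.Solver renaming (module +-*-Solver to ℤ-Solver)
open import Data.Rational as ℚ using (ℚ; _/_; 0ℚ; 1ℚ; _-_; _⊓_; toℚᵘ; NonNegative)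
import Data.Rational.Properties as ℚ
open import Data.Rational.Solver renaming (module +-*-Solver to ℚ-Solver)
open import Data.Rational.Unnormalised as ℚᵘ using (mkℚᵘ; *≡*)
import Data.Rational.Unnormalised.Properties as ℚᵘ
open import Data.Product using (∃; _×_; _,_; proj₁; proj₂; map₂)
open import Data.Product.Relation.Binary.Lex.Strict using (×-Lex; ×-isStrictTotalOrder)
open import Data.Sum using (inj₁; inj₂)
open import Data.Unit using (tt)
open import Data.Empty using (⊥-elim)
open import Algebra.Properties.CommutativeMonoid.Sum ℚ.+-0-commutativeMonoid using (sum; ∑-distrib-+; sum-cong-≗)
open import Algebra.Lattice.Properties.BooleanAlgebra Bool.∨-∧-booleanAlgebra using (deMorgan₂)
open import Function using (_∘_; id; Equivalence)
open import Function.Definitions using (Injective; StrictlySurjective)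
open import Relation.Binary using (Rel; IsStrictTotalOrder; Tri; tri<; tri≈; tri>)
open import Relation.Binary.Morphism using (IsOrderMonomorphism)
import Relation.Binary.Morphism.OrderMonomorphism as OrderMonomorphism
import Relation.Binary.Reasoning.Setoid as SetoidReasoning
open import Relation.Nullary using (¬_; Dec; does; proof; yes; no)
open import Relation.Nullary.Reflects using (Reflects; ofʸ; ofⁿ)
open import Relation.Nullary.Decidable using (⌊_⌋; toWitness; fromWitness; dec-true; dec-false; decidable-stable)
open import Relation.Binary.PropositionalEquality

insert : ∀ {n} → Fin n → (Fin n → Bool) → (Fin n → Bool)
insert v P u = P u ∨ does (u ≟ v)

card : ∀ {n} → (Fin n → Bool) → ℕ
card {zero}  P = 0
card {suc n} P = if P Fin.zero then suc (card (P ∘ Fin.suc)) else card (P ∘ Fin.suc)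

count-tabulate : ∀ {m n} (f : Fin m → Fin n) (P : Fin n → Bool) →
  foldr (λ v acc → if P v then suc acc else acc) 0 (tabulate f) ≡ card (P ∘ f)
count-tabulate {zero}  f P = refl
count-tabulate {suc m} f P with P (f Fin.zero)
... | true  = cong suc (count-tabulate (f ∘ Fin.suc) P)
... | false = count-tabulate (f ∘ Fin.suc) P

count≡card : ∀ {n} (P : Fin n → Bool) → count P ≡ card P
count≡card = count-tabulate id

card-cong : ∀ {n} {P Q : Fin n → Bool} → (∀ x → P x ≡ Q x) → card P ≡ card Q
card-cong {zero}  eq = refl
card-cong {suc n} eq rewrite eq Fin.zero = cong (λ k → if _ then suc k else k) (card-cong (eq ∘ Fin.suc))

card-mono : ∀ {n} {P Q : Fin n → Bool} → (∀ x → T (P x) → T (Q x)) → card P ≤ card Q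
card-mono {zero} h = z≤n
card-mono {suc n} {P} {Q} h with P Fin.zero | Q Fin.zero | h Fin.zero
... | true  | true  | _  = s≤s (card-mono (h ∘ Fin.suc))
... | true  | false | h₀ = ⊥-elim (h₀ tt)
... | false | true  | _  = ℕ.m≤n⇒m≤1+n (card-mono (h ∘ Fin.suc))
... | false | false | _  = card-mono (h ∘ Fin.suc)

card-mono-< : ∀ {n} {P Q : Fin n → Bool} → (∀ x → T (P x) → T (Q x)) →
  ∀ y → ¬ T (P y) → T (Q y) → card P < card Q
card-mono-< {suc n} {P} {Q} h Fin.zero ¬Py Qy with P Fin.zero | Q Fin.zero
... | false | true  = s≤s (card-mono (h ∘ Fin.suc))
... | true  | _     = ⊥-elim (¬Py tt)
card-mono-< {suc n} {P} {Q} h (Fin.suc y) ¬Py Qy with P Fin.zero | Q Fin.zero | h Fin.zero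
... | true  | true  | _  = s≤s (card-mono-< (h ∘ Fin.suc) y ¬Py Qy)
... | true  | false | h₀ = ⊥-elim (h₀ tt)
... | false | true  | _  = ℕ.m≤n⇒m≤1+n (card-mono-< (h ∘ Fin.suc) y ¬Py Qy)
... | false | false | _  = card-mono-< (h ∘ Fin.suc) y ¬Py Qy

card-false : ∀ n → card {n} (λ _ → false) ≡ 0
card-false zero    = refl
card-false (suc n) = card-false n

card-true : ∀ n → card {n} (λ _ → true) ≡ n
card-true zero    = refl
card-true (suc n) = cong suc (card-true n)

card-split : ∀ {n} (P Q : Fin n → Bool) →
  card P ≡ card (λ x → P x ∧ Q x) ℕ.+ card (λ x → P x ∧ not (Q x))
card-split {zero}  P Q = refl
card-split {suc n} P Q with P Fin.zero | Q Fin.zero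
... | true  | true  = cong suc (card-split (P ∘ Fin.suc) (Q ∘ Fin.suc))
... | true  | false = trans (cong suc (card-split (P ∘ Fin.suc) (Q ∘ Fin.suc))) (sym (ℕ.+-suc _ _))
... | false | _     = card-split (P ∘ Fin.suc) (Q ∘ Fin.suc)

card-∧-≟ : ∀ {n} (P : Fin n → Bool) (v : Fin n) →
  card (λ x → P x ∧ does (x ≟ v)) ≡ (if P v then 1 else 0)
card-∧-≟ {suc n} P Fin.zero with P Fin.zero
... | true  = cong suc (trans (card-cong {n} (λ x → Bool.∧-zeroʳ (P (Fin.suc x)))) (card-false n))
... | false = trans (card-cong {n} (λ x → Bool.∧-zeroʳ (P (Fin.suc x)))) (card-false n)
card-∧-≟ {suc n} P (Fin.suc v) with P Fin.zero
... | true  = card-∧-≟ (P ∘ Fin.suc) v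
... | false = card-∧-≟ (P ∘ Fin.suc) v

card-pos : ∀ {n} {P : Fin n → Bool} x → T (P x) → 0 < card P
card-pos {n} {P} x Px = subst (_< card P) (card-false n) (card-mono-< {Q = P} (λ _ ()) x (λ ()) Px)

maxℕ-upper : ∀ {A : Set} (f : A → ℕ) {x xs} → x ∈ xs → f x ≤ maxℕ xs f
maxℕ-upper f {xs = y ∷ ys} (here refl) = ℕ.m≤m⊔n (f y) (maxℕ ys f)
maxℕ-upper f {xs = y ∷ ys} (there x∈ys) = ℕ.≤-trans (maxℕ-upper f x∈ys) (ℕ.m≤n⊔m (f y) (maxℕ ys f))

maxℕ-closed : ∀ {A : Set} (Q : ℕ → Set) (f : A → ℕ) xs → Q 0 → (∀ x → Q (f x)) → Q (maxℕ xs f)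
maxℕ-closed Q f []       Q0 Qf = Q0
maxℕ-closed Q f (x ∷ xs) Q0 Qf with ℕ.⊔-sel (f x) (maxℕ xs f)
... | inj₁ eq = subst Q (sym eq) (Qf x)
... | inj₂ eq = subst Q (sym eq) (maxℕ-closed Q f xs Q0 Qf)

foldr-⊔-upper : ∀ {A : Set} (f : A → ℚ) {x xs} → x ∈ xs → f x ℚ.≤ foldr (λ y acc → f y ℚ.⊔ acc) 0ℚ xs
foldr-⊔-upper f {xs = y ∷ ys} (here refl)  = ℚ.p≤p⊔q (f y) _
foldr-⊔-upper f {xs = y ∷ ys} (there x∈ys) = ℚ.≤-trans (foldr-⊔-upper f x∈ys) (ℚ.p≤q⊔p (f y) _)

fromℕ : ℕ → ℚ
fromℕ n = + n / 1

/-nonNeg : ∀ a d .{{_ : NonZero d}} → NonNegative (+ a / d)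
/-nonNeg a d = ℚ.normalize-nonNeg a d

fromℕ-nonNeg : ∀ n → NonNegative (fromℕ n)
fromℕ-nonNeg n = /-nonNeg n 1

private
  toℚᵘ-/ : ∀ a d → toℚᵘ (+ a / suc d) ℚᵘ.≃ mkℚᵘ (+ a) d
  toℚᵘ-/ a d = ℚ.toℚᵘ-fromℚᵘ (mkℚᵘ (+ a) d)

fromℕ-+ : ∀ a b → fromℕ (a ℕ.+ b) ≡ fromℕ a ℚ.+ fromℕ b
fromℕ-+ a b = ℚ.toℚᵘ-injective (begin
  toℚᵘ (fromℕ (a ℕ.+ b))                ≈⟨ toℚᵘ-/ (a ℕ.+ b) 0 ⟩
  mkℚᵘ (+ (a ℕ.+ b)) 0                  ≈⟨ *≡* integers ⟩
  mkℚᵘ (+ a) 0 ℚᵘ.+ mkℚᵘ (+ b) 0        ≈⟨ ℚᵘ.+-cong (toℚᵘ-/ a 0) (toℚᵘ-/ b 0) ⟨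
  toℚᵘ (fromℕ a) ℚᵘ.+ toℚᵘ (fromℕ b)    ≈⟨ ℚ.toℚᵘ-homo-+ (fromℕ a) (fromℕ b) ⟨
  toℚᵘ (fromℕ a ℚ.+ fromℕ b)            ∎)
  where
  open SetoidReasoning ℚᵘ.≃-setoid
  open ℤ-Solver using (solve; _:+_; _:*_; con; _:=_)
  integers : + (a ℕ.+ b) ℤ.* + 1 ≡ (+ a ℤ.* + 1 ℤ.+ + b ℤ.* + 1) ℤ.* + 1
  integers = trans (cong (ℤ._* + 1) (ℤ.pos-+ a b))
    (solve 2 (λ x y → (x :+ y) :* con (+ 1) := (x :* con (+ 1) :+ y :* con (+ 1)) :* con (+ 1))
      refl (+ a) (+ b))

fromℕ-mono-≤ : ∀ {a b} → a ≤ b → fromℕ a ℚ.≤ fromℕ b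
fromℕ-mono-≤ {a} {b} a≤b = begin
  fromℕ a                    ≡⟨ ℚ.+-identityʳ (fromℕ a) ⟨
  fromℕ a ℚ.+ 0ℚ             ≤⟨ ℚ.+-monoʳ-≤ (fromℕ a) (ℚ.nonNegative⁻¹ _ {{fromℕ-nonNeg (b ℕ.∸ a)}}) ⟩
  fromℕ a ℚ.+ fromℕ (b ℕ.∸ a) ≡⟨ fromℕ-+ a (b ℕ.∸ a) ⟨
  fromℕ (a ℕ.+ (b ℕ.∸ a))    ≡⟨ cong fromℕ (ℕ.m+[n∸m]≡n a≤b) ⟩
  fromℕ b                    ∎
  where open ℚ.≤-Reasoning

fromℕ-*-/ : ∀ d t .{{_ : NonZero d}} → fromℕ d ℚ.* (+ t / d) ≡ fromℕ t
fromℕ-*-/ (suc d) t = ℚ.toℚᵘ-injective (begin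
  toℚᵘ (fromℕ (suc d) ℚ.* (+ t / suc d))          ≈⟨ ℚ.toℚᵘ-homo-* (fromℕ (suc d)) (+ t / suc d) ⟩
  toℚᵘ (fromℕ (suc d)) ℚᵘ.* toℚᵘ (+ t / suc d)    ≈⟨ ℚᵘ.*-cong (toℚᵘ-/ (suc d) 0) (toℚᵘ-/ t d) ⟩
  mkℚᵘ (+ suc d) 0 ℚᵘ.* mkℚᵘ (+ t) d              ≈⟨ *≡* integers ⟩
  mkℚᵘ (+ t) 0                                    ≈⟨ toℚᵘ-/ t 0 ⟨
  toℚᵘ (fromℕ t)                                  ∎)
  where
  open SetoidReasoning ℚᵘ.≃-setoid
  open ℤ-Solver using (solve; _:+_; _:*_; con; _:=_)
  integers : + suc d ℤ.* + t ℤ.* + 1 ≡ + t ℤ.* (+ 1 ℤ.* + suc d)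
  integers = solve 2 (λ x y → x :* y :* con (+ 1) := y :* (con (+ 1) :* x)) refl (+ suc d) (+ t)

/-*-/-inverse : ∀ a b .{{_ : NonZero a}} .{{_ : NonZero b}} → (+ a / b) ℚ.* (+ b / a) ≡ 1ℚ
/-*-/-inverse (suc a) (suc b) = ℚ.toℚᵘ-injective (begin
  toℚᵘ ((+ suc a / suc b) ℚ.* (+ suc b / suc a))       ≈⟨ ℚ.toℚᵘ-homo-* (+ suc a / suc b) (+ suc b / suc a) ⟩
  toℚᵘ (+ suc a / suc b) ℚᵘ.* toℚᵘ (+ suc b / suc a)   ≈⟨ ℚᵘ.*-cong (toℚᵘ-/ (suc a) b) (toℚᵘ-/ (suc b) a) ⟩
  mkℚᵘ (+ suc a) b ℚᵘ.* mkℚᵘ (+ suc b) a               ≈⟨ *≡* integers ⟩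
  mkℚᵘ (+ 1) 0                                         ≈⟨ toℚᵘ-/ 1 0 ⟨
  toℚᵘ 1ℚ                                              ∎)
  where
  open SetoidReasoning ℚᵘ.≃-setoid
  open ℤ-Solver using (solve; _:+_; _:*_; con; _:=_)
  integers : + suc a ℤ.* + suc b ℤ.* + 1 ≡ + 1 ℤ.* (+ suc b ℤ.* + suc a)
  integers = solve 2 (λ x y → x :* y :* con (+ 1) := con (+ 1) :* (y :* x)) refl (+ suc a) (+ suc b)

sum-mono-≤ : ∀ {n} {f g : Fin n → ℚ} → (∀ x → f x ℚ.≤ g x) → sum f ℚ.≤ sum g
sum-mono-≤ {zero}  f≤g = ℚ.≤-refl
sum-mono-≤ {suc n} f≤g = ℚ.+-mono-≤ (f≤g Fin.zero) (sum-mono-≤ (f≤g ∘ Fin.suc))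

sum-if : ∀ {n} (P : Fin n → Bool) (c : ℚ) →
  sum (λ x → if P x then c else 0ℚ) ≡ fromℕ (card P) ℚ.* c
sum-if {zero}  P c = sym (ℚ.*-zeroˡ c)
sum-if {suc n} P c with P Fin.zero
... | false = trans (ℚ.+-identityˡ _) (sum-if (P ∘ Fin.suc) c)
... | true  = begin
  c ℚ.+ sum (λ x → if P (Fin.suc x) then c else 0ℚ) ≡⟨ cong (c ℚ.+_) (sum-if (P ∘ Fin.suc) c) ⟩
  c ℚ.+ fromℕ k ℚ.* c                                ≡⟨ solve 2 (λ c x → c :+ x :* c := (con 1ℚ :+ x) :* c) refl c (fromℕ k) ⟩
  (1ℚ ℚ.+ fromℕ k) ℚ.* c                             ≡⟨ cong (ℚ._* c) (fromℕ-+ 1 k) ⟨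
  fromℕ (suc k) ℚ.* c                                ∎
  where
  open ≡-Reasoning
  open ℚ-Solver using (solve; _:+_; _:*_; con; _:=_)
  k = card (P ∘ Fin.suc)

sum-≟ : ∀ {n} (v : Fin n) (c : ℚ) → sum (λ x → if does (x ≟ v) then c else 0ℚ) ≡ c
sum-≟ v c = trans (sum-if (λ x → does (x ≟ v)) c)
  (trans (cong (λ k → fromℕ k ℚ.* c) (card-∧-≟ (λ _ → true) v)) (ℚ.*-identityˡ c))

fromℕ-foldr-+ : ∀ {A : Set} {n} (f : Fin n → A) (h : A → ℕ) →
  fromℕ (foldr ℕ._+_ 0 (map h (tabulate f))) ≡ sum (fromℕ ∘ h ∘ f)
fromℕ-foldr-+ {n = zero}  f h = refl
fromℕ-foldr-+ {n = suc n} f h =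
  trans (fromℕ-+ (h (f Fin.zero)) _) (cong (fromℕ (h (f Fin.zero)) ℚ.+_) (fromℕ-foldr-+ (f ∘ Fin.suc) h))

if-mono-≤ : ∀ b {x y : ℚ} → (T b → x ℚ.≤ y) → (if b then x else 0ℚ) ℚ.≤ (if b then y else 0ℚ)
if-mono-≤ true  x≤y = x≤y _
if-mono-≤ false _   = ℚ.≤-refl

module Weights (M : ℚ) (2≤M : fromℕ 2 ℚ.≤ M) where

  open ℚ.≤-Reasoning
  open ℚ-Solver using (solve; _:+_; _:*_; _:-_; con; _:=_)

  1≤M-1 : 1ℚ ℚ.≤ M - 1ℚ
  1≤M-1 = ℚ.+-monoˡ-≤ (ℚ.- 1ℚ) 2≤M

  M-nonNeg : NonNegative M
  M-nonNeg = ℚ.nonNegative (ℚ.≤-trans (fromℕ-mono-≤ {0} {2} ℕ.z≤n) 2≤M)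

  M-1-nonNeg : NonNegative (M - 1ℚ)
  M-1-nonNeg = ℚ.nonNegative (ℚ.≤-trans (fromℕ-mono-≤ {0} {1} ℕ.z≤n) 1≤M-1)

  -- Isolated vertices get weight 0, which is harmless: they have no neighbours outside any set.
  weight : ℕ → ℕ → ℚ
  weight zero      T = 0ℚ
  weight d@(suc _) T = (M ℚ.* (+ T / d)) ⊓ (M - 1ℚ)

  weight≤M-1 : ∀ d T → weight d T ℚ.≤ M - 1ℚ
  weight≤M-1 zero      T = ℚ.nonNegative⁻¹ _ {{M-1-nonNeg}}
  weight≤M-1 d@(suc _) T = ℚ.p⊓q≤q (M ℚ.* (+ T / d)) (M - 1ℚ)

  weight≤M*/ : ∀ d T .{{_ : NonZero d}} → weight d T ℚ.≤ M ℚ.* (+ T / d)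
  weight≤M*/ d@(suc _) T = ℚ.p⊓q≤p (M ℚ.* (+ T / d)) (M - 1ℚ)

  1≤M*/ : ∀ d T .{{_ : NonZero d}} .{{_ : NonZero T}} → + d / T ℚ.≤ M → 1ℚ ℚ.≤ M ℚ.* (+ T / d)
  1≤M*/ d T d/T≤M = begin
    1ℚ                          ≡⟨ /-*-/-inverse d T ⟨
    (+ d / T) ℚ.* (+ T / d)     ≤⟨ ℚ.*-monoʳ-≤-nonNeg (+ T / d) {{/-nonNeg T d}} d/T≤M ⟩
    M ℚ.* (+ T / d)             ∎

  1≤weight : ∀ d T .{{_ : NonZero d}} .{{_ : NonZero T}} → + d / T ℚ.≤ M → 1ℚ ℚ.≤ weight d T
  1≤weight d@(suc _) T d/T≤M = ℚ.⊓-glb (1≤M*/ d T d/T≤M) 1≤M-1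

  -- Applied with τ = t(v)/d(v) on an edge uv, where the edge condition reads t(u)/d(u) + τ ≥ 1.
  M-M*τ≤weight : ∀ d T (τ : ℚ) .{{_ : NonZero d}} →
    1ℚ ℚ.≤ (+ T / d) ℚ.+ τ → 1ℚ ℚ.≤ M ℚ.* τ → M - M ℚ.* τ ℚ.≤ weight d T
  M-M*τ≤weight d@(suc _) T τ edge 1≤Mτ = ℚ.⊓-glb ≤M*/ ≤M-1
    where
    ≤M*/ : M - M ℚ.* τ ℚ.≤ M ℚ.* (+ T / d)
    ≤M*/ = begin
      M - M ℚ.* τ               ≡⟨ solve 2 (λ m x → m :- m :* x := m :* (con 1ℚ :- x)) refl M τ ⟩
      M ℚ.* (1ℚ - τ)            ≤⟨ ℚ.*-monoˡ-≤-nonNeg M {{M-nonNeg}} (ℚ.+-monoˡ-≤ (ℚ.- τ) edge) ⟩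
      M ℚ.* ((+ T / d) ℚ.+ τ - τ) ≡⟨ cong (M ℚ.*_) (solve 2 (λ a x → a :+ x :- x := a) refl (+ T / d) τ) ⟩
      M ℚ.* (+ T / d)           ∎
    ≤M-1 : M - M ℚ.* τ ℚ.≤ M - 1ℚ
    ≤M-1 = ℚ.+-monoʳ-≤ M (ℚ.neg-antimono-≤ 1≤Mτ)

  -- With a = M t/d and d = k + x, t ≤ k: a x = M t - a k ≤ M k - a k.
  M*/*x≤k*[M-M*/] : ∀ d T k x .{{_ : NonZero d}} → d ≡ k ℕ.+ x → T ≤ k →
    (M ℚ.* (+ T / d)) ℚ.* fromℕ x ℚ.≤ fromℕ k ℚ.* (M - M ℚ.* (+ T / d))
  M*/*x≤k*[M-M*/] d T k x d≡k+x T≤k = begin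
    a ℚ.* fromℕ x                              ≡⟨ solve 3 (λ a x y → a :* x := (a :* (y :+ x)) :- a :* y) refl a (fromℕ x) (fromℕ k) ⟩
    a ℚ.* (fromℕ k ℚ.+ fromℕ x) - a ℚ.* fromℕ k ≡⟨ cong (λ z → a ℚ.* z - a ℚ.* fromℕ k) (fromℕ-+ k x) ⟨
    a ℚ.* fromℕ (k ℕ.+ x) - a ℚ.* fromℕ k      ≡⟨ cong (λ z → a ℚ.* fromℕ z - a ℚ.* fromℕ k) d≡k+x ⟨
    a ℚ.* fromℕ d - a ℚ.* fromℕ k              ≡⟨ cong (_- a ℚ.* fromℕ k) (solve 3 (λ m τ y → m :* τ :* y := m :* (y :* τ)) refl M τ (fromℕ d)) ⟩
    M ℚ.* (fromℕ d ℚ.* τ) - a ℚ.* fromℕ k      ≡⟨ cong (λ z → M ℚ.* z - a ℚ.* fromℕ k) (fromℕ-*-/ d T) ⟩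
    M ℚ.* fromℕ T - a ℚ.* fromℕ k              ≤⟨ ℚ.+-monoˡ-≤ (ℚ.- (a ℚ.* fromℕ k)) (ℚ.*-monoˡ-≤-nonNeg M {{M-nonNeg}} (fromℕ-mono-≤ T≤k)) ⟩
    M ℚ.* fromℕ k - a ℚ.* fromℕ k              ≡⟨ solve 3 (λ m a y → m :* y :- a :* y := y :* (m :- a)) refl M a (fromℕ k) ⟩
    fromℕ k ℚ.* (M - a)                        ∎
    where
    τ = + T / d
    a = M ℚ.* τ

module Activation {n} (G : Graph n) (t : Fin n → ℕ) (S : VSet n) where

  Active : ℕ → Fin n → Set
  Active k v = T (active G t S k v)

  active-step : ∀ {k} v → Active k v → Active (suc k) v
  active-step v p = Equivalence.from Bool.T-∨ (inj₁ p)

  active-mono : ∀ {j k} v → j ≤′ k → Active j v → Active k v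
  active-mono v ≤′-refl       = λ p → p
  active-mono v (≤′-step {k} j≤k) = active-step {k} v ∘ active-mono v j≤k

  threshold-reached : ∀ {k} v → ¬ Active k v → Active (suc k) v →
    t v ≤ card (λ u → adj G v u ∧ active G t S k u)
  threshold-reached {k} v ¬act act with Equivalence.to Bool.T-∨ act
  ... | inj₁ p = ⊥-elim (¬act p)
  ... | inj₂ p = subst (t v ≤_) (count≡card (λ u → adj G v u ∧ active G t S k u)) (ℕ.≤ᵇ⇒≤ (t v) _ p)

  -- firstActive L v is the first step at which v is active, provided it is active at step L.
  firstActive : ℕ → Fin n → ℕ
  firstActive zero    v = 0
  firstActive (suc L) v = if active G t S (firstActive L v) v then firstActive L v else suc L

  active-firstActive : ∀ L v → Active L v → Active (firstActive L v) v
  active-firstActive zero    v act = act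
  active-firstActive (suc L) v act with active G t S (firstActive L v) v in eq
  ... | true  = subst T (sym eq) tt
  ... | false = act

  inactive-before-firstActive : ∀ L v {j} → j < firstActive L v → ¬ Active j v
  inactive-before-firstActive (suc L) v j<τ act with active G t S (firstActive L v) v in eq
  ... | true  = inactive-before-firstActive L v j<τ act
  ... | false = subst T eq (active-firstActive L v (active-mono v (ℕ.≤⇒≤′ (ℕ.≤-pred j<τ)) act))

injective⇒strictlySurjective : ∀ {n} {f : Fin n → Fin n} → Injective _≡_ _≡_ f → StrictlySurjective _≡_ f
injective⇒strictlySurjective {suc m} {f} f-inj y with Fin.any? (λ x → f x Fin.≟ y)
... | yes hit = hit
... | no miss with Fin.pigeonhole (ℕ.n<1+n m) (λ x → Fin.punchOut (miss ∘ (x ,_) ∘ sym))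
...   | i , j , i<j , eq =
  ⊥-elim (Fin.<-irrefl (f-inj (Fin.punchOut-injective (miss ∘ (i ,_) ∘ sym) (miss ∘ (j ,_) ∘ sym) eq)) i<j)

injective⇒permutation : ∀ {n} (f : Fin n → Fin n) → Injective _≡_ _≡_ f → Permutation′ n
injective⇒permutation f f-inj = permutation f (proj₁ ∘ surj) (proj₂ ∘ surj) (λ x → f-inj (proj₂ (surj (f x))))
  where surj = injective⇒strictlySurjective f-inj

module Ranking {n} {ℓ : Level} {_≺_ : Rel (Fin n) ℓ} (sto : IsStrictTotalOrder _≡_ _≺_) where

  open IsStrictTotalOrder sto using (compare; _<?_) renaming (irrefl to ≺-irrefl; trans to ≺-trans)

  rank : Fin n → ℕ
  rank v = card (λ u → ⌊ u <? v ⌋)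

  rank-mono-< : ∀ {u v} → u ≺ v → rank u < rank v
  rank-mono-< {u} {v} u≺v = card-mono-< (λ x x≺u → fromWitness (≺-trans (toWitness x≺u) u≺v)) u
    (≺-irrefl refl ∘ toWitness) (fromWitness u≺v)

  rank<card : ∀ {v} (Q : Fin n → Bool) → (∀ u → u ≺ v → T (Q u)) → T (Q v) → rank v < card Q
  rank<card {v} Q before⇒Q Qv = card-mono-< (λ u → before⇒Q u ∘ toWitness) v (≺-irrefl refl ∘ toWitness) Qv

  card≤rank : ∀ {v} (Q : Fin n → Bool) → (∀ u → T (Q u) → u ≺ v) → card Q ≤ rank v
  card≤rank Q Q⇒before = card-mono (λ u → fromWitness ∘ Q⇒before u)

  rank<n : ∀ v → rank v < n
  rank<n v = subst (rank v <_) (card-true n) (card-mono-< _ v (≺-irrefl refl ∘ toWitness) _)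

  rank-injective : ∀ {u v} → rank u ≡ rank v → u ≡ v
  rank-injective {u} {v} eq with compare u v
  ... | tri< u≺v _ _ = ⊥-elim (ℕ.<-irrefl eq (rank-mono-< u≺v))
  ... | tri≈ _ u≡v _ = u≡v
  ... | tri> _ _ v≺u = ⊥-elim (ℕ.<-irrefl (sym eq) (rank-mono-< v≺u))

  ordering : Permutation′ n
  ordering = injective⇒permutation (λ v → fromℕ< (rank<n v))
    (rank-injective ∘ Fin.fromℕ<-injective _ _ (rank<n _) (rank<n _))

  toℕ-ordering : ∀ v → toℕ (ordering ⟨$⟩ʳ v) ≡ rank v
  toℕ-ordering v = Fin.toℕ-fromℕ< (rank<n v)

  rank-surjective : ∀ {i} → i < n → ∃ λ v → rank v ≡ i
  rank-surjective i<n = v , (begin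
    rank v                   ≡⟨ toℕ-ordering v ⟨
    toℕ (ordering ⟨$⟩ʳ v)    ≡⟨ cong toℕ (inverseʳ ordering) ⟩
    toℕ (fromℕ< i<n)         ≡⟨ Fin.toℕ-fromℕ< i<n ⟩
    _                        ∎)
    where
    open ≡-Reasoning
    v = ordering ⟨$⟩ˡ fromℕ< i<n

module LexicographicOrder {n} (κ : Fin n → ℕ) where

  lexKey : Fin n → ℕ × ℕ
  lexKey v = κ v , toℕ v

  _≺_ : Rel (Fin n) _
  u ≺ v = ×-Lex _≡_ _<_ _<_ (lexKey u) (lexKey v)

  ≺-isStrictTotalOrder : IsStrictTotalOrder _≡_ _≺_
  ≺-isStrictTotalOrder = OrderMonomorphism.isStrictTotalOrder lexKey-monomorphism
    (×-isStrictTotalOrder ℕ.<-isStrictTotalOrder ℕ.<-isStrictTotalOrder)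
    where
    lexKey-monomorphism : IsOrderMonomorphism _≡_ _ _≺_ _ lexKey
    lexKey-monomorphism = record
      { isOrderHomomorphism = record { cong = λ { refl → refl , refl } ; mono = id }
      ; injective = Fin.toℕ-injective ∘ proj₂
      ; cancel = id
      }

module Potential {n} (G : Graph n) where

  deg≡card : ∀ u → deg G u ≡ card (adj G u)
  deg≡card u = count≡card (adj G u)

  deg-nonZero : ∀ {u v} → T (adj G u v) → NonZero (deg G u)
  deg-nonZero {u} {v} uv = ℕ.>-nonZero (subst (0 <_) (sym (deg≡card u)) (card-pos v uv))

  deg≤maxDeg : ∀ u → deg G u ≤ maxDeg G
  deg≤maxDeg u = maxℕ-upper (deg G) (∈-allFin u)

  outside : VSet n → Fin n → ℕ
  outside P u = card (λ x → adj G u x ∧ not (P x))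

  boundary : VSet n → Fin n → ℕ
  boundary P u = card (λ x → adj G u x ∧ P u ∧ not (P x))

  outside≤deg : ∀ P u → outside P u ≤ deg G u
  outside≤deg P u = subst (outside P u ≤_) (sym (deg≡card u)) 
    (card-mono {Q = adj G u} (λ x → proj₁ ∘ Equivalence.to (Bool.T-∧ {adj G u x})))

  boundary≡ : ∀ P u → boundary P u ≡ (if P u then outside P u else 0)
  boundary≡ P u with P u
  ... | true  = refl
  ... | false = trans (card-cong (λ x → Bool.∧-zeroʳ (adj G u x))) (card-false n)

  fromℕ-cutSize : ∀ σ i → fromℕ (cutSize G σ i) ≡ sum (fromℕ ∘ boundary (inPrefix σ i))
  fromℕ-cutSize σ i = trans (fromℕ-foldr-+ (λ u → u) (count ∘ crossing))
    (sum-cong-≗ (cong fromℕ ∘ count≡card ∘ crossing))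
    where
    crossing : Fin n → Fin n → Bool
    crossing u x = adj G u x ∧ inPrefix σ i u ∧ not (inPrefix σ i x)

  outside-insert : ∀ {v P} → P v ≡ false → ∀ u →
    outside P u ≡ outside (insert v P) u ℕ.+ (if adj G u v then 1 else 0)
  outside-insert {v} {P} Pv u = begin
    outside P u
      ≡⟨ card-split (λ x → adj G u x ∧ not (P x)) (λ x → does (x ≟ v)) ⟩
    card (λ x → (adj G u x ∧ not (P x)) ∧ does (x ≟ v)) ℕ.+ card (λ x → (adj G u x ∧ not (P x)) ∧ not (does (x ≟ v)))
      ≡⟨ cong₂ ℕ._+_ (card-∧-≟ (λ x → adj G u x ∧ not (P x)) v) (card-cong λ x → outside-∧ (adj G u x) (P x) _) ⟩
    (if adj G u v ∧ not (P v) then 1 else 0) ℕ.+ outside (insert v P) u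
      ≡⟨ cong (λ b → (if adj G u v ∧ not b then 1 else 0) ℕ.+ outside (insert v P) u) Pv ⟩
    (if adj G u v ∧ true then 1 else 0) ℕ.+ outside (insert v P) u
      ≡⟨ cong (λ b → (if b then 1 else 0) ℕ.+ outside (insert v P) u) (Bool.∧-identityʳ (adj G u v)) ⟩
    (if adj G u v then 1 else 0) ℕ.+ outside (insert v P) u
      ≡⟨ ℕ.+-comm _ (outside (insert v P) u) ⟩
    outside (insert v P) u ℕ.+ (if adj G u v then 1 else 0) ∎
    where
    open ≡-Reasoning
    outside-∧ : ∀ a p q → (a ∧ not p) ∧ not q ≡ a ∧ not (p ∨ q)
    outside-∧ a p q = trans (Bool.∧-assoc a (not p) (not q)) (cong (a ∧_) (sym (deMorgan₂ p q)))

  module Weighted (t : Fin n → ℕ) (tpos : ∀ v → NonZero (t v))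
           (M : ℚ) (2≤M : fromℕ 2 ℚ.≤ M) (ratio≤M : ∀ v → ratio G t tpos v ℚ.≤ M) where

    open Weights M 2≤M

    w : Fin n → ℚ
    w u = weight (deg G u) (t u)

    share : VSet n → Fin n → ℚ
    share P u = if P u then w u ℚ.* fromℕ (outside P u) else 0ℚ

    potential : VSet n → ℚ
    potential P = sum (share P)

    potential-cong : ∀ {P Q} → (∀ u → P u ≡ Q u) → potential P ≡ potential Q
    potential-cong P≗Q = sum-cong-≗ λ u →
      cong₂ (λ b x → if b then w u ℚ.* fromℕ x else 0ℚ) (P≗Q u) (card-cong λ x → cong (λ b → adj G u x ∧ not b) (P≗Q x))

    x≤w*x : ∀ u x → x ≤ deg G u → fromℕ x ℚ.≤ w u ℚ.* fromℕ x
    x≤w*x u zero    _ = ℚ.≤-reflexive (sym (ℚ.*-zeroʳ (w u)))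
    x≤w*x u (suc x) x<deg = begin
      fromℕ (suc x)          ≡⟨ ℚ.*-identityˡ (fromℕ (suc x)) ⟨
      1ℚ ℚ.* fromℕ (suc x)   ≤⟨ ℚ.*-monoʳ-≤-nonNeg (fromℕ (suc x)) {{fromℕ-nonNeg (suc x)}} 1≤w ⟩
      w u ℚ.* fromℕ (suc x)  ∎
      where
      open ℚ.≤-Reasoning
      1≤w : 1ℚ ℚ.≤ w u
      1≤w = 1≤weight (deg G u) (t u) {{ℕ.>-nonZero (ℕ.<-≤-trans ℕ.z<s x<deg)}} {{tpos u}} (ratio≤M u)

    boundary≤share : ∀ P u → fromℕ (boundary P u) ℚ.≤ share P u
    boundary≤share P u = begin
      fromℕ (boundary P u)                         ≡⟨ cong fromℕ (boundary≡ P u) ⟩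
      fromℕ (if P u then outside P u else 0)       ≡⟨ Bool.if-float fromℕ (P u) ⟩
      (if P u then fromℕ (outside P u) else 0ℚ)    ≤⟨ if-mono-≤ (P u) (λ _ → x≤w*x u (outside P u) (outside≤deg P u)) ⟩
      share P u                                    ∎
      where open ℚ.≤-Reasoning

    cut≤potential : ∀ P → sum (fromℕ ∘ boundary P) ℚ.≤ potential P
    cut≤potential P = sum-mono-≤ (boundary≤share P)

    share≤ : ∀ P u → share P u ℚ.≤ (if P u then (M - 1ℚ) ℚ.* fromℕ (maxDeg G) else 0ℚ)
    share≤ P u = if-mono-≤ (P u) λ _ → begin
      w u ℚ.* fromℕ (outside P u)        ≤⟨ ℚ.*-monoʳ-≤-nonNeg (fromℕ (outside P u)) {{fromℕ-nonNeg (outside P u)}} (weight≤M-1 (deg G u) (t u)) ⟩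
      (M - 1ℚ) ℚ.* fromℕ (outside P u)   ≤⟨ ℚ.*-monoˡ-≤-nonNeg (M - 1ℚ) {{M-1-nonNeg}} (fromℕ-mono-≤ (ℕ.≤-trans (outside≤deg P u) (deg≤maxDeg u))) ⟩
      (M - 1ℚ) ℚ.* fromℕ (maxDeg G)      ∎
      where open ℚ.≤-Reasoning

    potential≤ : ∀ P → potential P ℚ.≤ (M - 1ℚ) ℚ.* fromℕ (maxDeg G) ℚ.* fromℕ (card P)
    potential≤ P = begin
      potential P                                        ≤⟨ sum-mono-≤ (share≤ P) ⟩
      sum (λ u → if P u then c else 0ℚ)                  ≡⟨ sum-if P c ⟩
      fromℕ (card P) ℚ.* c                               ≡⟨ ℚ.*-comm (fromℕ (card P)) c ⟩
      c ℚ.* fromℕ (card P)                               ∎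
      where
      open ℚ.≤-Reasoning
      c = (M - 1ℚ) ℚ.* fromℕ (maxDeg G)

    -- Adding v to P moves v's own share in, and removes one unit of out-degree,
    -- i.e. a share w u, from every neighbour u of v already in P.
    share-insert : ∀ {v P} → P v ≡ false → ∀ u →
      share (insert v P) u ℚ.+ (if adj G v u ∧ P u then w u else 0ℚ)
        ≡ share P u ℚ.+ (if does (u ≟ v) then w v ℚ.* fromℕ (outside (insert v P) v) else 0ℚ)
    share-insert {v} {P} Pv u = by-cases u (does (u ≟ v)) (proof (u ≟ v))
      where
      open ≡-Reasoning
      Y = w v ℚ.* fromℕ (outside (insert v P) v)
      by-cases : ∀ u b → Reflects (u ≡ v) b →
        (if P u ∨ b then w u ℚ.* fromℕ (outside (insert v P) u) else 0ℚ) ℚ.+ (if adj G v u ∧ P u then w u else 0ℚ)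
          ≡ share P u ℚ.+ (if b then Y else 0ℚ)
      by-cases .v true (ofʸ refl) = begin
        (if P v ∨ true then Y else 0ℚ) ℚ.+ (if adj G v v ∧ P v then w v else 0ℚ)
          ≡⟨ cong₂ ℚ._+_ (cong (λ b → if b then Y else 0ℚ) (Bool.∨-zeroʳ (P v)))
                         (cong (λ b → if b ∧ P v then w v else 0ℚ) (irrefl G v)) ⟩
        Y ℚ.+ 0ℚ
          ≡⟨ ℚ.+-comm Y 0ℚ ⟩
        0ℚ ℚ.+ Y
          ≡⟨ cong (λ b → (if b then w v ℚ.* fromℕ (outside P v) else 0ℚ) ℚ.+ Y) Pv ⟨
        share P v ℚ.+ Y ∎
      by-cases u false (ofⁿ _) = begin
        (if P u ∨ false then w u ℚ.* fromℕ x else 0ℚ) ℚ.+ (if adj G v u ∧ P u then w u else 0ℚ)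
          ≡⟨ cong (λ b → (if b then w u ℚ.* fromℕ x else 0ℚ) ℚ.+ (if adj G v u ∧ P u then w u else 0ℚ))
                  (Bool.∨-identityʳ (P u)) ⟩
        (if P u then w u ℚ.* fromℕ x else 0ℚ) ℚ.+ (if adj G v u ∧ P u then w u else 0ℚ)
          ≡⟨ release (P u) (adj G v u) ⟩
        (if P u then w u ℚ.* fromℕ (x ℕ.+ (if adj G v u then 1 else 0)) else 0ℚ) ℚ.+ 0ℚ
          ≡⟨ cong (λ y → (if P u then w u ℚ.* fromℕ y else 0ℚ) ℚ.+ 0ℚ)
                  (trans (outside-insert Pv u) (cong (λ b → x ℕ.+ (if b then 1 else 0)) (symm G u v))) ⟨
        share P u ℚ.+ 0ℚ ∎
        where
        x = outside (insert v P) u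
        release : ∀ p b → (if p then w u ℚ.* fromℕ x else 0ℚ) ℚ.+ (if b ∧ p then w u else 0ℚ)
                        ≡ (if p then w u ℚ.* fromℕ (x ℕ.+ (if b then 1 else 0)) else 0ℚ) ℚ.+ 0ℚ
        release false b     = cong (λ c → 0ℚ ℚ.+ (if c then w u else 0ℚ)) (Bool.∧-zeroʳ b)
        release true  false = cong (λ y → w u ℚ.* fromℕ y ℚ.+ 0ℚ) (sym (ℕ.+-identityʳ x))
        release true  true  = begin
          w u ℚ.* fromℕ x ℚ.+ w u          ≡⟨ solve 2 (λ a x → a :* x :+ a := a :* (x :+ con 1ℚ) :+ con 0ℚ) refl (w u) (fromℕ x) ⟩
          w u ℚ.* (fromℕ x ℚ.+ 1ℚ) ℚ.+ 0ℚ  ≡⟨ cong (λ y → w u ℚ.* y ℚ.+ 0ℚ) (fromℕ-+ x 1) ⟨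
          w u ℚ.* fromℕ (x ℕ.+ 1) ℚ.+ 0ℚ   ∎
          where open ℚ-Solver using (solve; _:+_; _:*_; con; _:=_)

    potential-insert : ∀ {v P} → P v ≡ false →
      potential (insert v P) ℚ.+ sum (λ u → if adj G v u ∧ P u then w u else 0ℚ)
        ≡ potential P ℚ.+ w v ℚ.* fromℕ (outside (insert v P) v)
    potential-insert {v} {P} Pv = begin
      potential (insert v P) ℚ.+ sum released          ≡⟨ ∑-distrib-+ (share (insert v P)) released ⟨
      sum (λ u → share (insert v P) u ℚ.+ released u)  ≡⟨ sum-cong-≗ (share-insert {v} {P} Pv) ⟩
      sum (λ u → share P u ℚ.+ gained u)               ≡⟨ ∑-distrib-+ (share P) gained ⟩
      potential P ℚ.+ sum gained                       ≡⟨ cong (potential P ℚ.+_) (sum-≟ v Y) ⟩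
      potential P ℚ.+ Y                                ∎
      where
      open ≡-Reasoning
      Y = w v ℚ.* fromℕ (outside (insert v P) v)
      released gained : Fin n → ℚ
      released u = if adj G v u ∧ P u then w u else 0ℚ
      gained u = if does (u ≟ v) then Y else 0ℚ

    M-M*τ≤w : EdgeCondition G t → ∀ {u v} {{_ : NonZero (deg G v)}} → T (adj G v u) →
      M - M ℚ.* (+ t v / deg G v) ℚ.≤ w u
    M-M*τ≤w edge {u} {v} {{dv}} vu =
      M-M*τ≤weight (deg G u) (t u) (+ t v / deg G v) {{du}}
        (edge u v (Equivalence.to Bool.T-≡ uv) du dv)
        (1≤M*/ (deg G v) (t v) {{dv}} {{tpos v}} (ratio≤M v))
      where
      uv : T (adj G u v)
      uv = subst T (symm G v u) vu
      du : NonZero (deg G u)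
      du = deg-nonZero uv

    potential-insert-≤ : EdgeCondition G t → ∀ {v P} → P v ≡ false →
      t v ≤ card (λ u → adj G v u ∧ P u) → potential (insert v P) ℚ.≤ potential P
    potential-insert-≤ edge {v} {P} Pv t≤k = begin
      potential (insert v P)                  ≡⟨ solve 2 (λ x y → x := (x :+ y) :- y) refl (potential (insert v P)) R ⟩
      (potential (insert v P) ℚ.+ R) - R      ≡⟨ cong (_- R) (potential-insert Pv) ⟩
      (potential P ℚ.+ Y) - R                 ≤⟨ ℚ.+-monoˡ-≤ (ℚ.- R) (ℚ.+-monoʳ-≤ (potential P) Y≤R) ⟩
      (potential P ℚ.+ R) - R                 ≡⟨ solve 2 (λ x y → (x :+ y) :- y := x) refl (potential P) R ⟩
      potential P                             ∎
      where
      open ℚ.≤-Reasoning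
      open ℚ-Solver using (solve; _:+_; _:-_; _:=_)
      k = card (λ u → adj G v u ∧ P u)
      x = outside (insert v P) v
      R = sum (λ u → if adj G v u ∧ P u then w u else 0ℚ)
      Y = w v ℚ.* fromℕ x
      deg≡k+x : deg G v ≡ k ℕ.+ x
      deg≡k+x = trans (deg≡card v) (trans (card-split (adj G v) P) (cong (k ℕ.+_) outside≡x))
        where
        outside≡x : outside P v ≡ x
        outside≡x = trans (outside-insert Pv v)
          (trans (cong (λ b → x ℕ.+ (if b then 1 else 0)) (irrefl G v)) (ℕ.+-identityʳ x))
      instance
        dv : NonZero (deg G v)
        dv = ℕ.>-nonZero (subst (0 <_) (sym deg≡k+x)
               (ℕ.<-≤-trans (ℕ.>-nonZero⁻¹ (t v) {{tpos v}}) (ℕ.≤-trans t≤k (ℕ.m≤m+n k x))))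
      a = M ℚ.* (+ t v / deg G v)
      Y≤R : Y ℚ.≤ R
      Y≤R = begin
        w v ℚ.* fromℕ x                                 ≤⟨ ℚ.*-monoʳ-≤-nonNeg (fromℕ x) {{fromℕ-nonNeg x}} (weight≤M*/ (deg G v) (t v)) ⟩
        a ℚ.* fromℕ x                                   ≤⟨ M*/*x≤k*[M-M*/] (deg G v) (t v) k x deg≡k+x t≤k ⟩
        fromℕ k ℚ.* (M - a)                             ≡⟨ sum-if (λ u → adj G v u ∧ P u) (M - a) ⟨
        sum (λ u → if adj G v u ∧ P u then M - a else 0ℚ) ≤⟨ sum-mono-≤ neighbour ⟩
        R                                               ∎
        where
        neighbour : ∀ u → (if adj G v u ∧ P u then M - a else 0ℚ) ℚ.≤ (if adj G v u ∧ P u then w u else 0ℚ)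
        neighbour u = if-mono-≤ (adj G v u ∧ P u) (M-M*τ≤w edge ∘ proj₁ ∘ Equivalence.to (Bool.T-∧ {adj G v u}))

module ActivationOrder {n} (G : Graph n) (t : Fin n → ℕ) (S : VSet n)
                       (K : ℕ) (all-active : ∀ v → Activation.Active G t S K v) where

  open Activation G t S

  τ : Fin n → ℕ
  τ = firstActive K

  τ-active : ∀ v → Active (τ v) v
  τ-active v = active-firstActive K v (all-active v)

  τ-minimal : ∀ {j} v → Active j v → τ v ≤ j
  τ-minimal v act = ℕ.≮⇒≥ (λ j<τ → inactive-before-firstActive K v j<τ act)

  τ≡0⇒S : ∀ {v} → τ v ≡ 0 → T (S v)
  τ≡0⇒S {v} τ≡0 = subst (λ j → Active j v) τ≡0 (τ-active v)

  S⇒τ≡0 : ∀ {v} → T (S v) → τ v ≡ 0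
  S⇒τ≡0 {v} Sv = ℕ.n≤0⇒n≡0 (τ-minimal v Sv)

  τ≡suc⇒threshold : ∀ {v j} → τ v ≡ suc j → t v ≤ card (λ u → adj G v u ∧ active G t S j u)
  τ≡suc⇒threshold {v} {j} τ≡1+j = threshold-reached {j} v
    (inactive-before-firstActive K v (subst (j <_) (sym τ≡1+j) (ℕ.n<1+n j)))
    (subst (λ k → Active k v) τ≡1+j (τ-active v))

  open LexicographicOrder τ
  open Ranking ≺-isStrictTotalOrder public

  rank<card-S : ∀ {v} → T (S v) → rank v < card S
  rank<card-S {v} Sv = rank<card S before⇒S Sv
    where
    before⇒S : ∀ u → u ≺ v → T (S u)
    before⇒S u (inj₁ τu<τv)       = ⊥-elim (ℕ.n≮0 (subst (τ u <_) (S⇒τ≡0 Sv) τu<τv))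
    before⇒S u (inj₂ (τu≡τv , _)) = τ≡0⇒S (trans τu≡τv (S⇒τ≡0 Sv))

  card-S≤rank : ∀ {v} → ¬ T (S v) → card S ≤ rank v
  card-S≤rank {v} ¬Sv = card≤rank S S⇒before
    where
    S⇒before : ∀ u → T (S u) → u ≺ v
    S⇒before u Su = inj₁ (subst (_< τ v) (sym (S⇒τ≡0 Su)) (ℕ.n≢0⇒n>0 (¬Sv ∘ τ≡0⇒S)))

  prefix : ℕ → VSet n
  prefix i u = rank u <ᵇ i

  inPrefix-ordering : ∀ i u → inPrefix ordering i u ≡ prefix i u
  inPrefix-ordering i u = cong (_<ᵇ i) (toℕ-ordering u)

  prefix⊆S : ∀ {i} → i ≤ card S → ∀ u → T (prefix i u) → T (S u)
  prefix⊆S {i} i≤r u u∈P = decidable-stable (T? (S u)) λ ¬Su →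
    ℕ.<⇒≱ (ℕ.<ᵇ⇒< (rank u) i u∈P) (ℕ.≤-trans i≤r (card-S≤rank ¬Su))

  prefix-full : ∀ {i} → n ≤ i → ∀ u → prefix (suc i) u ≡ prefix i u
  prefix-full {i} n≤i u = trans (dec-true (rank u ℕ.<? suc i) (ℕ.m<n⇒m<1+n u<i)) (sym (dec-true (rank u ℕ.<? i) u<i))
    where u<i = ℕ.<-≤-trans (rank<n u) n≤i

  prefix-suc : ∀ {i v} → rank v ≡ i → ∀ u → prefix (suc i) u ≡ insert v (prefix i) u
  prefix-suc {i} {v} rv u = by-cases u (does (u ≟ v)) (proof (u ≟ v))
    where
    by-cases : ∀ u b → Reflects (u ≡ v) b → prefix (suc i) u ≡ prefix i u ∨ b
    by-cases .v true (ofʸ refl) =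
      trans (dec-true (rank v ℕ.<? suc i) (s≤s (ℕ.≤-reflexive rv))) (sym (Bool.∨-zeroʳ (prefix i v)))
    by-cases u false (ofⁿ u≢v) = trans (same (ℕ.<-cmp (rank u) i)) (sym (Bool.∨-identityʳ (prefix i u)))
      where
      same : Tri (rank u < i) (rank u ≡ i) (i < rank u) → prefix (suc i) u ≡ prefix i u
      same (tri< u<i _ _)  = trans (dec-true (rank u ℕ.<? suc i) (ℕ.m<n⇒m<1+n u<i)) (sym (dec-true (rank u ℕ.<? i) u<i))
      same (tri≈ _ ru≡i _) = ⊥-elim (u≢v (rank-injective (trans ru≡i (sym rv))))
      same (tri> _ _ i<u)  = trans (dec-false (rank u ℕ.<? suc i) (ℕ.<⇒≱ i<u ∘ ℕ.≤-pred)) (sym (dec-false (rank u ℕ.<? i) (ℕ.<⇒≯ i<u)))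

  prefix-excludes : ∀ {i v} → rank v ≡ i → prefix i v ≡ false
  prefix-excludes {i} {v} rv = dec-false (rank v ℕ.<? i) (ℕ.<-irrefl rv)

  -- Past the seeds, the vertex in position i was activated by neighbours active strictly earlier,
  -- all of which lie in the prefix of length i.
  threshold-in-prefix : ∀ {i v} → card S ≤ i → rank v ≡ i → t v ≤ card (λ u → adj G v u ∧ prefix i u)
  threshold-in-prefix {i} {v} r≤i rv = by-activation-time (τ v) refl
    where
    by-activation-time : ∀ k → τ v ≡ k → t v ≤ card (λ u → adj G v u ∧ prefix i u)
    by-activation-time zero    τv = ⊥-elim (ℕ.<⇒≱ (rank<card-S (τ≡0⇒S τv)) (subst (card S ≤_) (sym rv) r≤i))
    by-activation-time (suc j) τv = ℕ.≤-trans (τ≡suc⇒threshold τv) (card-mono earlier)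
      where
      earlier : ∀ u → T (adj G v u ∧ active G t S j u) → T (adj G v u ∧ prefix i u)
      earlier u = Equivalence.from (Bool.T-∧ {adj G v u}) ∘ map₂ in-prefix ∘ Equivalence.to (Bool.T-∧ {adj G v u})
        where
        in-prefix : Active j u → T (prefix i u)
        in-prefix act = ℕ.<⇒<ᵇ (subst (rank u <_) rv (rank-mono-< (inj₁ (subst (τ u <_) (sym τv) (s≤s (τ-minimal u act))))))

  module _ (tpos : ∀ v → NonZero (t v)) (M : ℚ) (2≤M : fromℕ 2 ℚ.≤ M)
           (ratio≤M : ∀ v → ratio G t tpos v ℚ.≤ M) (edge : EdgeCondition G t) where

    open Potential G
    open Weighted t tpos M 2≤M ratio≤M
    open Weights M 2≤M using (M-1-nonNeg)

    bound : ℚ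
    bound = (M - 1ℚ) ℚ.* fromℕ (maxDeg G) ℚ.* fromℕ (size S)

    potential-seeds≤ : ∀ {i} → i ≤ card S → potential (prefix i) ℚ.≤ bound
    potential-seeds≤ {i} i≤r = ℚ.≤-trans (potential≤ (prefix i))
      (ℚ.*-monoˡ-≤-nonNeg ((M - 1ℚ) ℚ.* fromℕ (maxDeg G))
        {{ℚ.nonNeg*nonNeg⇒nonNeg (M - 1ℚ) {{M-1-nonNeg}} (fromℕ (maxDeg G)) {{fromℕ-nonNeg (maxDeg G)}}}}
        (fromℕ-mono-≤ (ℕ.≤-trans (card-mono (prefix⊆S i≤r)) (ℕ.≤-reflexive (sym (count≡card S))))))

    potential-prefix≤ : ∀ i → potential (prefix i) ℚ.≤ bound
    potential-prefix≤ zero = potential-seeds≤ z≤n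
    potential-prefix≤ (suc i) = step (suc i ℕ.≤? card S) (i ℕ.<? n)
      where
      open ℚ.≤-Reasoning
      step : Dec (suc i ≤ card S) → Dec (i < n) → potential (prefix (suc i)) ℚ.≤ bound
      step (yes i<r) _         = potential-seeds≤ i<r
      step (no  i≮r) (no  i≮n) = begin
        potential (prefix (suc i))        ≡⟨ potential-cong (prefix-full (ℕ.≮⇒≥ i≮n)) ⟩
        potential (prefix i)              ≤⟨ potential-prefix≤ i ⟩
        bound                             ∎
      step (no  i≮r) (yes i<n) = inserting (rank-surjective i<n)
        where
        inserting : ∃ (λ v → rank v ≡ i) → potential (prefix (suc i)) ℚ.≤ bound
        inserting (v , rv) = begin
          potential (prefix (suc i))        ≡⟨ potential-cong (prefix-suc rv) ⟩
          potential (insert v (prefix i))   ≤⟨ potential-insert-≤ edge (prefix-excludes rv) (threshold-in-prefix (ℕ.≤-pred (ℕ.≰⇒> i≮r)) rv) ⟩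
          potential (prefix i)              ≤⟨ potential-prefix≤ i ⟩
          bound                             ∎

    cutSize≤ : ∀ i → fromℕ (cutSize G ordering i) ℚ.≤ bound
    cutSize≤ i = begin
      fromℕ (cutSize G ordering i)                            ≡⟨ fromℕ-cutSize ordering i ⟩
      sum (fromℕ ∘ boundary (inPrefix ordering i))            ≤⟨ cut≤potential (inPrefix ordering i) ⟩
      potential (inPrefix ordering i)                         ≡⟨ potential-cong (inPrefix-ordering i) ⟩
      potential (prefix i)                                    ≤⟨ potential-prefix≤ i ⟩
      bound                                                   ∎
      where open ℚ.≤-Reasoning

    width≤ : fromℕ (width G ordering) ℚ.≤ bound
    width≤ = maxℕ-closed (λ c → fromℕ c ℚ.≤ bound) (cutSize G ordering) (upTo (suc n))
      (ℚ.≤-trans (ℚ.nonNegative⁻¹ _ {{fromℕ-nonNeg (cutSize G ordering 0)}}) (cutSize≤ 0)) cutSize≤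

mainTheorem20 : (n : ℕ) (G : Graph n) (t : Fin n → ℕ)
    → (tpos : ∀ v → NonZero (t v))
    → EdgeCondition G t
    → (+ 2) / 1 ℚ.≤ M G t tpos
    → (S : VSet n) (r : ℕ) → size S ≡ r → Contagious G t S
    → CutwidthAtMost G ((M G t tpos - 1ℚ) ℚ.* ((+ maxDeg G) / 1) ℚ.* ((+ r) / 1))
mainTheorem20 n G t tpos edge 2≤M S .(size S) refl (K , contagious) =
  ordering , width≤ tpos (M G t tpos) 2≤M ratio≤M edge
  where
  all-active : ∀ v → Activation.Active G t S K v
  all-active v = Equivalence.from Bool.T-≡ (contagious v)
  open ActivationOrder G t S K all-active
  ratio≤M : ∀ v → ratio G t tpos v ℚ.≤ M G t tpos
  ratio≤M v = foldr-⊔-upper (ratio G t tpos) (∈-allFin v)
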